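{- Let $L$ be a finite distributive lattice. If the poset $J(L)$ is not an initial segment of a finite upper semilattice, then $L$ is not isomorphic to any interval $[\mathbf{a},\mathbf{b}]$ of the Muchnik lattice $\mathcal{M}_w$.
   Context: Mass problems are subsets of Baire space $\omega^\omega$. For mass problems $\mathcal{A},\mathcal{B}$, Muchnik reducibility is $\mathcal{A}\le_w\mathcal{B}$ iff for every $f\in\mathcal{B}$ there is $g\in\mathcal{A}$ with $g\le_T f$; $\equiv_w$ is the induced equivalence. The Muchnik lattice $\mathcal{M}_w$ is the set of $\equiv_w$-classes ordered by $\le_w$ (a distributive lattice). $[a,b]=\{x:a\le x\le b\}$. $J(L)$ is the set of nonzero join-irreducible elements of $L$, ordered as in $L$. A poset $P$ is an initial segment of a finite upper semilattice if $P$ is isomorphic to a downward closed subset of some finite partial order in which every two elements have a least upper bound. -}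

module Defs where

open import Level using (Level; _⊔_) renaming (suc to lsuc; zero to lzero)
open import Data.Nat using (ℕ; zero; suc)
open import Data.Fin using (Fin)
open import Data.Vec using (Vec; []; _∷_; lookup)
open import Data.Product using (Σ; ∃; _×_; _,_)
open import Data.Sum using (_⊎_)
open import Relation.Nullary using (¬_)
open import Relation.Binary.PropositionalEquality using (_≡_)
open import Algebra.Lattice.Bundles using (DistributiveLattice)

Baire : Set
Baire = ℕ → ℕ

-- Codes of partial recursive functions (of arity k) relative to an oracle.
data Code : ℕ → Set where
  zeroC : ∀ {k} → Code k
  succC : Code 1
  projC : ∀ {k} → Fin k → Code k
  oracC : Code 1
  compC : ∀ {k m} → Code m → Vec (Code k) m → Code k
  recC  : ∀ {k} → Code k → Code (suc (suc k)) → Code (suc k)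
  muC   : ∀ {k} → Code (suc k) → Code k

-- Big-step semantics: Eval f c xs n  means  Φ_c^f(xs) ↓ = n.
mutual
  data Eval (f : Baire) : ∀ {k} → Code k → Vec ℕ k → ℕ → Set where
    ev-zero : ∀ {k} {xs : Vec ℕ k} → Eval f zeroC xs 0
    ev-succ : ∀ {x} → Eval f succC (x ∷ []) (suc x)
    ev-proj : ∀ {k} {i : Fin k} {xs} → Eval f (projC i) xs (lookup xs i)
    ev-orac : ∀ {x} → Eval f oracC (x ∷ []) (f x)
    ev-comp : ∀ {k m} {g : Code m} {cs : Vec (Code k) m} {xs ys n} →
              EvalAll f cs xs ys → Eval f g ys n → Eval f (compC g cs) xs n
    ev-rec0 : ∀ {k} {g : Code k} {h} {xs n} →
              Eval f g xs n → Eval f (recC g h) (0 ∷ xs) n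
    ev-recS : ∀ {k} {g : Code k} {h} {m r xs n} →
              Eval f (recC g h) (m ∷ xs) r → Eval f h (m ∷ r ∷ xs) n →
              Eval f (recC g h) (suc m ∷ xs) n
    ev-mu   : ∀ {k} {c : Code (suc k)} {xs n} →
              MuFrom f c xs 0 n → Eval f (muC c) xs n

  data EvalAll (f : Baire) {k : ℕ} : ∀ {m} → Vec (Code k) m → Vec ℕ k → Vec ℕ m → Set where
    ea-nil  : ∀ {xs} → EvalAll f [] xs []
    ea-cons : ∀ {m} {c} {cs : Vec (Code k) m} {xs y ys} →
              Eval f c xs y → EvalAll f cs xs ys → EvalAll f (c ∷ cs) xs (y ∷ ys)

  -- MuFrom f c xs i n : searching from i, n is the least j ≥ i with
  -- c(j, xs) = 0, and c(j', xs) is defined and nonzero for i ≤ j' < n.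
  data MuFrom (f : Baire) {k : ℕ} (c : Code (suc k)) (xs : Vec ℕ k) : ℕ → ℕ → Set where
    mu-found : ∀ {i} → Eval f c (i ∷ xs) 0 → MuFrom f c xs i i
    mu-step  : ∀ {i v n} → Eval f c (i ∷ xs) (suc v) → MuFrom f c xs (suc i) n →
               MuFrom f c xs i n

_≤T_ : Baire → Baire → Set
g ≤T f = Σ (Code 1) λ c → ∀ n → Eval f c (n ∷ []) (g n)

MassProblem : Set₁
MassProblem = Baire → Set

_≤w_ : MassProblem → MassProblem → Set
A ≤w B = ∀ f → B f → Σ Baire λ g → A g × (g ≤T f)

_≡w_ : MassProblem → MassProblem → Set
A ≡w B = (A ≤w B) × (B ≤w A)

module _ {c ℓ : Level} (L : DistributiveLattice c ℓ) where
  open DistributiveLattice L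

  _≤L_ : Carrier → Carrier → Set ℓ
  x ≤L y = (x ∧ y) ≈ x

  IsFiniteLattice : Set (c ⊔ ℓ)
  IsFiniteLattice = Σ ℕ λ n → Σ (Fin n → Carrier) λ e → ∀ x → ∃ λ i → e i ≈ x

  -- nonzero join-irreducible element
  IsJoinIrreducible : Carrier → Set (c ⊔ ℓ)
  IsJoinIrreducible x =
    (¬ (∀ y → x ≤L y)) ×
    (∀ y z → x ≈ (y ∨ z) → (x ≈ y) ⊎ (x ≈ z))

  JCarrier : Set (c ⊔ ℓ)
  JCarrier = Σ Carrier IsJoinIrreducible

  _≤J_ : JCarrier → JCarrier → Set ℓ
  (x , _) ≤J (y , _) = x ≤L y

  -- L is isomorphic (as a lattice, equivalently as a poset) to the
  -- interval [a , b] of the Muchnik lattice (taken up to ≡w).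
  IsoToMuchnikInterval : MassProblem → MassProblem → Set (lsuc lzero ⊔ c ⊔ ℓ)
  IsoToMuchnikInterval a b =
    Σ (Carrier → MassProblem) λ ψ →
      (∀ x → (a ≤w ψ x) × (ψ x ≤w b)) ×
      (∀ x y → (x ≤L y → ψ x ≤w ψ y) × (ψ x ≤w ψ y → x ≤L y)) ×
      (∀ X → a ≤w X → X ≤w b → ∃ λ x → ψ x ≡w X)

record FiniteUSL : Set₁ where
  field
    size    : ℕ
    _⊑_     : Fin size → Fin size → Set
    ⊑-refl  : ∀ i → i ⊑ i
    ⊑-trans : ∀ {i j k} → i ⊑ j → j ⊑ k → i ⊑ k
    ⊑-antisym : ∀ {i j} → i ⊑ j → j ⊑ i → i ≡ j
    join    : Fin size → Fin size → Fin size
    join-ub₁ : ∀ i j → i ⊑ join i j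
    join-ub₂ : ∀ i j → j ⊑ join i j
    join-least : ∀ i j k → i ⊑ k → j ⊑ k → join i j ⊑ k

IsInitialSegmentOf : ∀ {p r} (P : Set p) (_≤_ : P → P → Set r) → FiniteUSL → Set (p ⊔ r)
IsInitialSegmentOf P _≤_ U =
  Σ (P → Fin size) λ φ →
    (∀ x y → (x ≤ y → φ x ⊑ φ y) × (φ x ⊑ φ y → x ≤ y)) ×
    (∀ x i → i ⊑ φ x → ∃ λ y → φ y ≡ i)
  where open FiniteUSL U

IsInitialSegmentOfFiniteUSL : ∀ {p r} (P : Set p) (_≤_ : P → P → Set r) → Set (lsuc lzero ⊔ p ⊔ r)
IsInitialSegmentOfFiniteUSL P _≤_ = Σ FiniteUSL λ U → IsInitialSegmentOf P _≤_ U

{-# OPTIONS --safe #-}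
module Submission where

-- Let ψ : L ≅ [a, b]. An oracle k solving a determines cone k, the preimage of
-- "solve b or compute k", and k solves ψ w exactly when w ≤ cone k. An oracle j
-- solving a but not b determines avoid j, the preimage of "solve a without being
-- computable from j", and avoid j ≤ w exactly when j does not solve ψ w. So L splits
-- into the filter above avoid j and the ideal below cone j, which makes avoid j
-- join-irreducible. Conversely every join-irreducible p is split off in this way by
-- the cone of some oracle k_p, and p ≤ r forces k_p ≤T k_r. Hence if p, q ∈ J(L) lie
-- below some r ∈ J(L), then avoid (k_p ⊕ k_q) is their least upper bound in J(L), and
-- adjoining a top to a finite poset with such bounded joins gives a finite upper
-- semilattice of which it is an initial segment.

open import Level using (Level; _⊔_)
open import Data.Nat using (ℕ; zero; suc; _+_)
open import Data.Fin using (Fin; zero; suc)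
open import Data.Fin.Properties using (any?; all?; ¬∀⟶∃¬)
open import Data.Vec using (Vec; []; _∷_)
import Data.Vec.Functional as Vector
open import Data.List using (List; foldr; filter; tabulate)
open import Data.List.Relation.Unary.All using (All; []; _∷_)
open import Data.List.Relation.Unary.All.Properties using (all-filter)
open import Data.List.Relation.Unary.Any using (here; there)
open import Data.List.Membership.Propositional using (_∈_)
open import Data.List.Membership.Propositional.Properties using (∈-filter⁺; ∈-tabulate⁺)
open import Data.Product using (Σ; ∃; ∃₂; _×_; _,_; proj₁; proj₂; swap)
open import Data.Sum using (_⊎_; inj₁; inj₂; [_,_])
open import Data.Unit using (⊤; tt)
open import Data.Empty using (⊥; ⊥-elim)
open import Function using (_∘_)
open import Function.Bundles using (_⇔_; mk⇔; Equivalence)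
open import Relation.Nullary using (¬_; Dec; yes; no; ¬?)
open import Relation.Nullary.Decidable
  using (True; toWitness; fromWitness; _×-dec_; _→-dec_; map′; decidable-stable; ¬¬-excluded-middle)
open import Relation.Nullary.Negation using (¬¬-map; contradiction)
open import Relation.Binary.Core using (Rel)
open import Relation.Binary.Structures using (IsEquivalence)
open import Relation.Binary.Definitions using (Reflexive; Transitive; Decidable)
open import Relation.Binary.PropositionalEquality using (_≡_; refl; cong; subst)
open import Relation.Unary using (Pred) renaming (Decidable to Decidable₁)
open import Algebra.Lattice.Bundles using (DistributiveLattice)
open import Algebra.Lattice.Properties.Lattice using (∨-∧-orderTheoreticLattice)
import Relation.Binary.Lattice.Bundles as Order

open import Defs

≤T-refl : ∀ {f} → f ≤T f
≤T-refl = oracC , λ _ → ev-orac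

module ReplaceOracle (c : Code 1) where

  mutual
    replace : ∀ {k} → Code k → Code k
    replace zeroC        = zeroC
    replace succC        = succC
    replace (projC i)    = projC i
    replace oracC        = c
    replace (compC d ds) = compC (replace d) (replaceAll ds)
    replace (recC d d′)  = recC (replace d) (replace d′)
    replace (muC d)      = muC (replace d)

    replaceAll : ∀ {k m} → Vec (Code k) m → Vec (Code k) m
    replaceAll []       = []
    replaceAll (d ∷ ds) = replace d ∷ replaceAll ds

  module _ {f g : Baire} (c-computes-f : ∀ n → Eval g c (n ∷ []) (f n)) where

    mutual
      replace-correct : ∀ {k} {d : Code k} {xs n} → Eval f d xs n → Eval g (replace d) xs n
      replace-correct ev-zero           = ev-zero
      replace-correct ev-succ           = ev-succ
      replace-correct ev-proj           = ev-proj
      replace-correct (ev-orac {x})     = c-computes-f x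
      replace-correct (ev-comp es e)    = ev-comp (replaceAll-correct es) (replace-correct e)
      replace-correct (ev-rec0 e)       = ev-rec0 (replace-correct e)
      replace-correct (ev-recS e e′)    = ev-recS (replace-correct e) (replace-correct e′)
      replace-correct (ev-mu μ)         = ev-mu (replaceMu-correct μ)

      replaceAll-correct : ∀ {k m} {ds : Vec (Code k) m} {xs ys} →
                           EvalAll f ds xs ys → EvalAll g (replaceAll ds) xs ys
      replaceAll-correct ea-nil        = ea-nil
      replaceAll-correct (ea-cons e es) = ea-cons (replace-correct e) (replaceAll-correct es)

      replaceMu-correct : ∀ {k} {d : Code (suc k)} {xs i n} →
                          MuFrom f d xs i n → MuFrom g (replace d) xs i n
      replaceMu-correct (mu-found e)  = mu-found (replace-correct e)
      replaceMu-correct (mu-step e μ) = mu-step (replace-correct e) (replaceMu-correct μ)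

≤T-trans : ∀ {f g h} → f ≤T g → g ≤T h → f ≤T h
≤T-trans (d , d-computes-f) (c , c-computes-g) =
  replace d , λ n → replace-correct c-computes-g (d-computes-f n)
  where open ReplaceOracle c

-- Single primitive recursions (rather than ⌊_/2⌋ and _%_) so that the codes below
-- follow them clause by clause.
double : ℕ → ℕ
double zero    = zero
double (suc n) = suc (suc (double n))

isZero : ℕ → ℕ
isZero zero    = 1
isZero (suc _) = 0

parity : ℕ → ℕ
parity zero    = 0
parity (suc n) = isZero (parity n)

half : ℕ → ℕ
half zero    = 0
half (suc n) = parity n + half n

branch : ℕ → ℕ → ℕ → ℕ
branch zero    x _ = x
branch (suc _) _ y = y

infixr 6 _⊕_
_⊕_ : Baire → Baire → Baire
(f ⊕ g) n = branch (parity n) (f (half n)) (g (half n))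

parity-double : ∀ n → parity (double n) ≡ 0
parity-double zero = refl
parity-double (suc n) rewrite parity-double n = refl

half-double : ∀ n → half (double n) ≡ n
half-double zero = refl
half-double (suc n) rewrite parity-double n | half-double n = refl

⊕-even : ∀ f g n → (f ⊕ g) (double n) ≡ f n
⊕-even f g n rewrite parity-double n | half-double n = refl

⊕-odd : ∀ f g n → (f ⊕ g) (suc (double n)) ≡ g n
⊕-odd f g n rewrite parity-double n | half-double n = refl

doubleC : Code 1
doubleC = recC zeroC (compC succC (compC succC (projC (suc zero) ∷ []) ∷ []))

doubleC-correct : ∀ f n → Eval f doubleC (n ∷ []) (double n)
doubleC-correct f zero    = ev-rec0 ev-zero
doubleC-correct f (suc n) =
  ev-recS (doubleC-correct f n)
          (ev-comp (ea-cons (ev-comp (ea-cons ev-proj ea-nil) ev-succ) ea-nil) ev-succ)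

isZeroC : Code 1
isZeroC = recC (compC succC (zeroC ∷ [])) zeroC

isZeroC-correct : ∀ f n → Eval f isZeroC (n ∷ []) (isZero n)
isZeroC-correct f zero    = ev-rec0 (ev-comp (ea-cons ev-zero ea-nil) ev-succ)
isZeroC-correct f (suc n) = ev-recS (isZeroC-correct f n) ev-zero

parityC : Code 1
parityC = recC zeroC (compC isZeroC (projC (suc zero) ∷ []))

parityC-correct : ∀ f n → Eval f parityC (n ∷ []) (parity n)
parityC-correct f zero    = ev-rec0 ev-zero
parityC-correct f (suc n) =
  ev-recS (parityC-correct f n) (ev-comp (ea-cons ev-proj ea-nil) (isZeroC-correct f _))

plusC : Code 2
plusC = recC (projC zero) (compC succC (projC (suc zero) ∷ []))

plusC-correct : ∀ f x y → Eval f plusC (x ∷ y ∷ []) (x + y)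
plusC-correct f zero    y = ev-rec0 ev-proj
plusC-correct f (suc x) y =
  ev-recS (plusC-correct f x y) (ev-comp (ea-cons ev-proj ea-nil) ev-succ)

halfC : Code 1
halfC = recC zeroC (compC plusC (compC parityC (projC zero ∷ []) ∷ projC (suc zero) ∷ []))

halfC-correct : ∀ f n → Eval f halfC (n ∷ []) (half n)
halfC-correct f zero    = ev-rec0 ev-zero
halfC-correct f (suc n) =
  ev-recS (halfC-correct f n)
          (ev-comp (ea-cons (ev-comp (ea-cons ev-proj ea-nil) (parityC-correct f n))
                            (ea-cons ev-proj ea-nil))
                   (plusC-correct f _ _))

⊕-upperˡ : ∀ f g → f ≤T (f ⊕ g)
⊕-upperˡ f g = compC oracC (doubleC ∷ []) , λ n →
  subst (Eval (f ⊕ g) _ (n ∷ [])) (⊕-even f g n)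
        (ev-comp (ea-cons (doubleC-correct (f ⊕ g) n) ea-nil) ev-orac)

⊕-upperʳ : ∀ f g → g ≤T (f ⊕ g)
⊕-upperʳ f g = compC oracC (compC succC (doubleC ∷ []) ∷ []) , λ n →
  subst (Eval (f ⊕ g) _ (n ∷ [])) (⊕-odd f g n)
        (ev-comp (ea-cons (ev-comp (ea-cons (doubleC-correct (f ⊕ g) n) ea-nil) ev-succ) ea-nil)
                 ev-orac)

⊕-least : ∀ {f g h} → f ≤T h → g ≤T h → (f ⊕ g) ≤T h
⊕-least {f} {g} {h} (cf , cf-correct) (cg , cg-correct) =
  compC branchC (parityC ∷ projC zero ∷ []) , λ n →
    ev-comp (ea-cons (parityC-correct h n) (ea-cons ev-proj ea-nil)) (branchC-correct n (parity n))
  where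
  branchC : Code 2
  branchC = recC (compC cf (halfC ∷ []))
                 (compC cg (compC halfC (projC (suc (suc zero)) ∷ []) ∷ []))

  branchC-correct : ∀ n m → Eval h branchC (m ∷ n ∷ []) (branch m (f (half n)) (g (half n)))
  branchC-correct n zero    = ev-rec0 (ev-comp (ea-cons (halfC-correct h n) ea-nil) (cf-correct _))
  branchC-correct n (suc m) =
    ev-recS (branchC-correct n m)
            (ev-comp (ea-cons (ev-comp (ea-cons ev-proj ea-nil) (halfC-correct h n)) ea-nil)
                     (cg-correct _))

¬¬-∀-Fin : ∀ {n p} {P : Fin n → Set p} → (∀ i → ¬ ¬ P i) → ¬ ¬ (∀ i → P i)
¬¬-∀-Fin {zero}  _   ¬all = ¬all λ ()
¬¬-∀-Fin {suc n} ¬¬P ¬all =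
  ¬¬P zero λ P0 → ¬¬-∀-Fin (¬¬P ∘ suc) λ Psuc → ¬all λ { zero → P0 ; (suc i) → Psuc i }

record Enumeration {a ℓ} (A : Set a) (_~_ : Rel A ℓ) : Set (a ⊔ ℓ) where
  field
    size     : ℕ
    elem     : Fin size → A
    onto     : ∀ x → ∃ λ i → elem i ~ x
    distinct : ∀ {i j} → elem i ~ elem j → i ≡ j

module _ {c ℓ q} {C : Set c} {_~_ : Rel C ℓ} (~-isEquivalence : IsEquivalence _~_)
         (_~?_ : Decidable _~_) {Q : Pred C q} (Q? : Decidable₁ Q)
         where

  open IsEquivalence ~-isEquivalence renaming (refl to ~-refl; sym to ~-sym; trans to ~-trans)

  _~₁_ : Rel (Σ C Q) ℓ
  x ~₁ y = proj₁ x ~ proj₁ y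

  private
    Covers : ∀ {m n} → (Fin m → Σ C Q) → (Fin n → C) → Set (ℓ ⊔ q)
    Covers e′ e = ∀ i → Q (e i) → ∃ λ j → proj₁ (e′ j) ~ e i

    Distinct : ∀ {m} → (Fin m → Σ C Q) → Set ℓ
    Distinct e′ = ∀ {j k} → e′ j ~₁ e′ k → j ≡ k

    select : ∀ {n} (e : Fin n → C) → ∃₂ λ m (e′ : Fin m → Σ C Q) → Covers e′ e × Distinct e′
    select {zero}  e = 0 , (λ ()) , (λ ()) , λ { {()} }
    select {suc n} e with select (e ∘ suc)
    ... | m , e′ , covers , distinct with Q? (e zero) | any? (λ j → proj₁ (e′ j) ~? e zero)
    ...   | no ¬q | _             = m , e′ , (λ { zero q → ⊥-elim (¬q q) ; (suc i) → covers i }) , distinct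
    ...   | yes q | yes (j , e′j~e0) = m , e′ , (λ { zero _ → j , e′j~e0 ; (suc i) → covers i }) , distinct
    ...   | yes q | no new        = suc m , (e zero , q) Vector.∷ e′ , covers′ , distinct′
      where
      covers′ : Covers ((e zero , q) Vector.∷ e′) e
      covers′ zero    _ = zero , ~-refl
      covers′ (suc i) q = let j , e′j~ei = covers i q in suc j , e′j~ei

      distinct′ : Distinct ((e zero , q) Vector.∷ e′)
      distinct′ {zero}  {zero}  _    = refl
      distinct′ {zero}  {suc k} e0~k = ⊥-elim (new (k , ~-sym e0~k))
      distinct′ {suc j} {zero}  j~e0 = ⊥-elim (new (j , j~e0))
      distinct′ {suc j} {suc k} j~k  = cong suc (distinct j~k)

  enumerateSubset : ∀ {n} (e : Fin n → C) → (∀ x → ∃ λ i → e i ~ x) →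
                    (∀ {x y} → x ~ y → Q x → Q y) → Enumeration (Σ C Q) _~₁_
  enumerateSubset e e-onto Q-resp with select e
  ... | m , e′ , covers , distinct = record
    { size = m ; elem = e′ ; onto = onto ; distinct = distinct }
    where
    onto : ∀ x → ∃ λ j → e′ j ~₁ x
    onto (x , qx) =
      let i , ei~x  = e-onto x
          j , e′j~ei = covers i (Q-resp (~-sym ei~x) qx)
      in  j , ~-trans e′j~ei ei~x

module _ {a r} {A : Set a} (_≤_ : Rel A r) where

  _≤≥_ : Rel A r
  x ≤≥ y = x ≤ y × y ≤ x

  IsLub : A → A → A → Set (a ⊔ r)
  IsLub x y s = x ≤ s × y ≤ s × (∀ t → x ≤ t → y ≤ t → s ≤ t)

  -- Stated up to ¬¬: in a finite poset with decidable order the existence of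
  -- a join is decidable, so this is as good as having the joins.
  BoundedJoins : Set (a ⊔ r)
  BoundedJoins = ∀ x y z → x ≤ z → y ≤ z → ¬ ¬ ∃ (IsLub x y)

module _ {a r} {A : Set a} {_≤_ : Rel A r} (≤-refl : Reflexive _≤_) (≤-trans : Transitive _≤_)
         (_≤?_ : Decidable _≤_) (enum : Enumeration A (_≤≥_ _≤_)) (joins : BoundedJoins _≤_)
         where

  open Enumeration enum

  -- Adjoining a top element zero makes the partial join operation total.
  private
    _⊑_ : Fin (suc size) → Fin (suc size) → Set
    _     ⊑ zero  = ⊤
    zero  ⊑ suc _ = ⊥
    suc i ⊑ suc j = True (elem i ≤? elem j)

    ⊑-refl : ∀ u → u ⊑ u
    ⊑-refl zero    = tt
    ⊑-refl (suc i) = fromWitness ≤-refl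

    ⊑-trans : ∀ {u v w} → u ⊑ v → v ⊑ w → u ⊑ w
    ⊑-trans {w = zero}                   _   _   = tt
    ⊑-trans {suc i} {suc j} {suc k} i⊑j j⊑k = fromWitness (≤-trans (toWitness i⊑j) (toWitness j⊑k))

    ⊑-antisym : ∀ {u v} → u ⊑ v → v ⊑ u → u ≡ v
    ⊑-antisym {zero}  {zero}  _   _   = refl
    ⊑-antisym {suc i} {suc j} i⊑j j⊑i = cong suc (distinct (toWitness i⊑j , toWitness j⊑i))

    IsLubAt : Fin size → Fin size → Fin size → Set r
    IsLubAt i j k = elem i ≤ elem k × elem j ≤ elem k ×
                    (∀ l → elem i ≤ elem l → elem j ≤ elem l → elem k ≤ elem l)

    lubAt? : ∀ i j → Dec (∃ (IsLubAt i j))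
    lubAt? i j = any? λ k → (elem i ≤? elem k) ×-dec (elem j ≤? elem k) ×-dec
                   all? (λ l → (elem i ≤? elem l) →-dec (elem j ≤? elem l) →-dec (elem k ≤? elem l))

    lub⇒lubAt : ∀ {i j} → ∃ (IsLub _≤_ (elem i) (elem j)) → ∃ (IsLubAt i j)
    lub⇒lubAt (s , i≤s , j≤s , least) =
      let k , k≤s , s≤k = onto s
      in  k , ≤-trans i≤s s≤k , ≤-trans j≤s s≤k , λ l i≤l j≤l → ≤-trans k≤s (least (elem l) i≤l j≤l)

    joinBy : ∀ {i j} → Dec (∃ (IsLubAt i j)) → Fin (suc size)
    joinBy (yes (k , _)) = suc k
    joinBy (no _)        = zero

    join : Fin (suc size) → Fin (suc size) → Fin (suc size)
    join (suc i) (suc j) = joinBy (lubAt? i j)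
    join _       _       = zero

    join-ub₁ : ∀ u v → u ⊑ join u v
    join-ub₁ (suc i) (suc j) with lubAt? i j
    ... | yes (_ , i≤k , _) = fromWitness i≤k
    ... | no _              = tt
    join-ub₁ zero    _       = tt
    join-ub₁ (suc i) zero    = tt

    join-ub₂ : ∀ u v → v ⊑ join u v
    join-ub₂ (suc i) (suc j) with lubAt? i j
    ... | yes (_ , _ , j≤k , _) = fromWitness j≤k
    ... | no _                  = tt
    join-ub₂ zero    _       = tt
    join-ub₂ (suc i) zero    = tt

    join-least : ∀ u v w → u ⊑ w → v ⊑ w → join u v ⊑ w
    join-least _       _       zero    _   _   = tt
    join-least (suc i) (suc j) (suc k) i⊑k j⊑k with lubAt? i j
    ... | yes (_ , _ , _ , least) = fromWitness (least k (toWitness i⊑k) (toWitness j⊑k))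
    ... | no ¬lub = ⊥-elim (joins (elem i) (elem j) (elem k) (toWitness i⊑k) (toWitness j⊑k)
                                  (¬lub ∘ lub⇒lubAt))

    withTop : FiniteUSL
    withTop = record
      { size       = suc size
      ; _⊑_        = _⊑_
      ; ⊑-refl     = ⊑-refl
      ; ⊑-trans    = λ {u v w} → ⊑-trans {u} {v} {w}
      ; ⊑-antisym  = λ {u v} → ⊑-antisym {u} {v}
      ; join       = join
      ; join-ub₁   = join-ub₁
      ; join-ub₂   = join-ub₂
      ; join-least = join-least
      }

    index : A → Fin (suc size)
    index x = suc (proj₁ (onto x))

    index-embedding : ∀ x y → (x ≤ y → index x ⊑ index y) × (index x ⊑ index y → x ≤ y)
    index-embedding x y =
      let i , i≤x , x≤i = onto x
          j , j≤y , y≤j = onto y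
      in  (λ x≤y → fromWitness (≤-trans i≤x (≤-trans x≤y y≤j))) ,
          (λ i⊑j → ≤-trans x≤i (≤-trans (toWitness i⊑j) j≤y))

    index-downClosed : ∀ x u → u ⊑ index x → ∃ λ y → index y ≡ u
    index-downClosed x (suc i) _ =
      elem i , cong suc (distinct (proj₂ (onto (elem i))))

  boundedJoins⇒initialSegment : IsInitialSegmentOfFiniteUSL A _≤_
  boundedJoins⇒initialSegment = withTop , index , index-embedding , index-downClosed

module LatticeOrder {c ℓ} (L : DistributiveLattice c ℓ) where

  open DistributiveLattice L renaming (refl to ≈-refl)

  private
    module O = Order.Lattice (∨-∧-orderTheoreticLattice lattice)

  infix 4 _≤_
  _≤_ : Carrier → Carrier → Set ℓ
  _≤_ = _≤L_ L

  JI : Carrier → Set (c ⊔ ℓ)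
  JI = IsJoinIrreducible L

  -- _≤L_ is the order of the standard library up to the orientation of ≈.
  ≤-refl : ∀ {x} → x ≤ x
  ≤-refl = sym O.refl

  ≤-trans : ∀ {x y z} → x ≤ y → y ≤ z → x ≤ z
  ≤-trans x≤y y≤z = sym (O.trans (sym x≤y) (sym y≤z))

  ≤-antisym : ∀ {x y} → x ≤ y → y ≤ x → x ≈ y
  ≤-antisym x≤y y≤x = O.antisym (sym x≤y) (sym y≤x)

  ≈⇒≤ : ∀ {x y} → x ≈ y → x ≤ y
  ≈⇒≤ x≈y = sym (O.reflexive x≈y)

  x≤x∨y : ∀ x y → x ≤ x ∨ y
  x≤x∨y x y = sym (O.x≤x∨y x y)

  y≤x∨y : ∀ x y → y ≤ x ∨ y
  y≤x∨y x y = sym (O.y≤x∨y x y)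

  ∨-least : ∀ {x y z} → x ≤ z → y ≤ z → x ∨ y ≤ z
  ∨-least x≤z y≤z = sym (O.∨-least (sym x≤z) (sym y≤z))

  ≤-resp-≈ : ∀ {x x′ y y′} → x ≈ x′ → y ≈ y′ → x ≤ y → x′ ≤ y′
  ≤-resp-≈ x≈x′ y≈y′ x≤y = ≤-trans (≈⇒≤ (sym x≈x′)) (≤-trans x≤y (≈⇒≤ y≈y′))

  ≤≥-isEquivalence : IsEquivalence (_≤≥_ _≤_)
  ≤≥-isEquivalence = record
    { refl  = ≤-refl , ≤-refl
    ; sym   = swap
    ; trans = λ (x≤y , y≤x) (y≤z , z≤y) → ≤-trans x≤y y≤z , ≤-trans z≤y y≤x
    }

  ∈⇒≤foldr-∨ : ∀ {x y xs} → x ∈ xs → x ≤ foldr _∨_ y xs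
  ∈⇒≤foldr-∨ (here refl) = x≤x∨y _ _
  ∈⇒≤foldr-∨ (there x∈xs) = ≤-trans (∈⇒≤foldr-∨ x∈xs) (y≤x∨y _ _)

  JI-resp-≈ : ∀ {x y} → x ≈ y → JI x → JI y
  JI-resp-≈ x≈y (nonzero , irreducible) =
    (λ y≤all → nonzero (λ z → ≤-trans (≈⇒≤ x≈y) (y≤all z))) ,
    λ u v y≈u∨v → Data.Sum.map (trans (sym x≈y)) (trans (sym x≈y)) (irreducible u v (trans x≈y y≈u∨v))

  JI⇒joinPrime : ∀ {p x y} → JI p → p ≤ x ∨ y → p ≤ x ⊎ p ≤ y
  JI⇒joinPrime {p} {x} {y} (_ , irreducible) p≤x∨y
    with irreducible (p ∧ x) (p ∧ y) (trans (sym p≤x∨y) (∧-distribˡ-∨ p x y))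
  ... | inj₁ p≈p∧x = inj₁ (sym p≈p∧x)
  ... | inj₂ p≈p∧y = inj₂ (sym p≈p∧y)

  JI⇒≰foldr-∨ : ∀ {p y xs} → JI p → All (λ x → ¬ p ≤ x) xs → ¬ p ≤ y → ¬ p ≤ foldr _∨_ y xs
  JI⇒≰foldr-∨ jp []            p≰y = p≰y
  JI⇒≰foldr-∨ jp (p≰x ∷ p≰xs) p≰y =
    [ p≰x , JI⇒≰foldr-∨ jp p≰xs p≰y ] ∘ JI⇒joinPrime jp

  Splits : Carrier → Carrier → Set (c ⊔ ℓ)
  Splits p m = ∀ w → p ≤ w ⇔ (¬ w ≤ m)

  module _ (_≤?_ : Decidable _≤_) where

    Splits⇒JI : ∀ {p m} → Splits p m → JI p
    Splits⇒JI {p} {m} split = nonzero , irreducible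
      where
      open Equivalence

      nonzero : ¬ (∀ y → p ≤ y)
      nonzero p≤all = to (split m) (p≤all m) ≤-refl

      irreducible : ∀ y z → p ≈ y ∨ z → p ≈ y ⊎ p ≈ z
      irreducible y z p≈y∨z with y ≤? m | z ≤? m
      ... | no y≰m | _      = inj₁ (≤-antisym (from (split y) y≰m) (≤-trans (x≤x∨y y z) (≈⇒≤ (sym p≈y∨z))))
      ... | yes _  | no z≰m = inj₂ (≤-antisym (from (split z) z≰m) (≤-trans (y≤x∨y y z) (≈⇒≤ (sym p≈y∨z))))
      ... | yes y≤m | yes z≤m = contradiction (∨-least y≤m z≤m) (to (split (y ∨ z)) (≈⇒≤ p≈y∨z))

  module Finite (finite : IsFiniteLattice L) where

    private
      n : ℕ
      n = proj₁ finite

      e : Fin n → Carrier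
      e = proj₁ (proj₂ finite)

      e-onto : ∀ x → ∃ λ i → e i ≈ x
      e-onto = proj₂ (proj₂ finite)

    ¬¬-decidable-≤ : ¬ ¬ Decidable _≤_
    ¬¬-decidable-≤ = ¬¬-map extend (¬¬-∀-Fin λ _ → ¬¬-∀-Fin λ _ → ¬¬-excluded-middle)
      where
      extend : (∀ i j → Dec (e i ≤ e j)) → Decidable _≤_
      extend _≤?ᵢ_ x y =
        let i , ei≈x = e-onto x
            j , ej≈y = e-onto y
        in  map′ (≤-resp-≈ ei≈x ej≈y) (≤-resp-≈ (sym ei≈x) (sym ej≈y)) (i ≤?ᵢ j)

    ¬¬-decidable-JI : ¬ ¬ Decidable₁ JI
    ¬¬-decidable-JI = ¬¬-map extend (¬¬-∀-Fin λ _ → ¬¬-excluded-middle)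
      where
      extend : (∀ i → Dec (JI (e i))) → Decidable₁ JI
      extend JI?ᵢ x =
        let i , ei≈x = e-onto x
        in  map′ (JI-resp-≈ ei≈x) (JI-resp-≈ (sym ei≈x)) (JI?ᵢ i)

    module _ (_≤?_ : Decidable _≤_) where

      JI⇒Splits : ∀ {p} → JI p → ∃ (Splits p)
      JI⇒Splits {p} jp@(nonzero , _) =
        m , λ w → mk⇔ (λ p≤w w≤m → p≰m (≤-trans p≤w w≤m))
                      (λ w≰m → decidable-stable (p ≤? w) (w≰m ∘ ≰p⇒≤m))
        where
        notAbove : List Carrier
        notAbove = filter (λ x → ¬? (p ≤? x)) (tabulate e)

        some-notAbove : ∃ λ i → ¬ p ≤ e i
        some-notAbove = ¬∀⟶∃¬ n (λ i → p ≤ e i) (λ i → p ≤? e i)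
          (λ p≤e → nonzero λ y → let i , ei≈y = e-onto y in ≤-resp-≈ ≈-refl ei≈y (p≤e i))

        m : Carrier
        m = foldr _∨_ (e (proj₁ some-notAbove)) notAbove

        p≰m : ¬ p ≤ m
        p≰m = JI⇒≰foldr-∨ jp (all-filter (λ x → ¬? (p ≤? x)) (tabulate e)) (proj₂ some-notAbove)

        ≰p⇒≤m : ∀ {w} → ¬ p ≤ w → w ≤ m
        ≰p⇒≤m {w} p≰w =
          let i , ei≈w = e-onto w
              p≰ei     = p≰w ∘ ≤-resp-≈ ≈-refl ei≈w
          in  ≤-resp-≈ ei≈w ≈-refl (∈⇒≤foldr-∨ (∈-filter⁺ (λ x → ¬? (p ≤? x)) (∈-tabulate⁺ i) p≰ei))

      enumerateJ : Decidable₁ JI → Enumeration (JCarrier L) (_≤≥_ (_≤J_ L))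
      enumerateJ JI? =
        enumerateSubset ≤≥-isEquivalence (λ x y → (x ≤? y) ×-dec (y ≤? x)) JI? e
          (λ x → let i , ei≈x = e-onto x in i , ≈⇒≤ ei≈x , ≈⇒≤ (sym ei≈x))
          (λ (x≤y , y≤x) → JI-resp-≈ (≤-antisym x≤y y≤x))

Solves : MassProblem → Baire → Set
Solves A k = ∃ λ g → A g × g ≤T k

solves-upward : ∀ {A k k′} → Solves A k → k ≤T k′ → Solves A k′
solves-upward (g , Ag , g≤k) k≤k′ = g , Ag , ≤T-trans g≤k k≤k′

≤w⇒solves : ∀ {A B k} → A ≤w B → Solves B k → Solves A k
≤w⇒solves A≤B (g , Bg , g≤k) = solves-upward (A≤B g Bg) g≤k

solves⇒≤w : ∀ {A B} → (∀ k → Solves B k → Solves A k) → A ≤w B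
solves⇒≤w B⇒A f Bf = B⇒A f (f , Bf , ≤T-refl)

module Interval {c ℓ} (L : DistributiveLattice c ℓ) (finite : IsFiniteLattice L)
                (_≤?_ : Decidable (_≤L_ L)) {a b : MassProblem} (iso : IsoToMuchnikInterval L a b)
                where

  open DistributiveLattice L using (Carrier)
  open LatticeOrder L
  open Finite finite using (JI⇒Splits)
  open Equivalence

  private
    ψ : Carrier → MassProblem
    ψ = proj₁ iso

    ψ-bounds : ∀ x → (a ≤w ψ x) × (ψ x ≤w b)
    ψ-bounds = proj₁ (proj₂ iso)

    ψ-embedding : ∀ x y → (x ≤ y → ψ x ≤w ψ y) × (ψ x ≤w ψ y → x ≤ y)
    ψ-embedding = proj₁ (proj₂ (proj₂ iso))

    preimage : ∀ X → a ≤w X → X ≤w b → ∃ λ x → ψ x ≡w X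
    preimage = proj₂ (proj₂ (proj₂ iso))

  ψ-antitone : ∀ {x y k} → x ≤ y → Solves (ψ y) k → Solves (ψ x) k
  ψ-antitone {x} {y} x≤y = ≤w⇒solves (proj₁ (ψ-embedding x y) x≤y)

  ψ-reflects : ∀ {x y} → (∀ k → Solves (ψ y) k → Solves (ψ x) k) → x ≤ y
  ψ-reflects {x} {y} y⇒x = proj₂ (ψ-embedding x y) (solves⇒≤w y⇒x)

  ψ⇒a : ∀ {w k} → Solves (ψ w) k → Solves a k
  ψ⇒a {w} = ≤w⇒solves (proj₁ (ψ-bounds w))

  b⇒ψ : ∀ {w k} → Solves b k → Solves (ψ w) k
  b⇒ψ {w} = ≤w⇒solves (proj₂ (ψ-bounds w))

  module WithinBounds (a≤b : a ≤w b) where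

    ConeProblem : Baire → MassProblem
    ConeProblem k f = Solves b f ⊎ k ≤T f

    private
      conePreimage : ∀ {k} → Solves a k → ∃ λ x → ψ x ≡w ConeProblem k
      conePreimage ak = preimage _
        (λ { f (inj₁ bf) → ≤w⇒solves a≤b bf ; f (inj₂ k≤f) → solves-upward ak k≤f })
        (λ f bf → f , inj₁ (f , bf , ≤T-refl) , ≤T-refl)

    cone : ∀ {k} → Solves a k → Carrier
    cone = proj₁ ∘ conePreimage

    ≤cone⇔solves : ∀ {k} (ak : Solves a k) w → w ≤ cone ak ⇔ Solves (ψ w) k
    ≤cone⇔solves {k} ak w = mk⇔ (λ w≤cone → ψ-antitone w≤cone solves-cone) solves⇒≤cone
      where
      ψcone≡wC : ψ (cone ak) ≡w ConeProblem k
      ψcone≡wC = proj₂ (conePreimage ak)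

      solves-cone : Solves (ψ (cone ak)) k
      solves-cone = ≤w⇒solves (proj₁ ψcone≡wC) (k , inj₂ ≤T-refl , ≤T-refl)

      solves⇒≤cone : Solves (ψ w) k → w ≤ cone ak
      solves⇒≤cone ψwk = ψ-reflects λ f ψcone-f → case (≤w⇒solves (proj₂ ψcone≡wC) ψcone-f)
        where
        case : ∀ {f} → Solves (ConeProblem k) f → Solves (ψ w) f
        case (g , inj₁ bg , g≤f) = b⇒ψ (solves-upward bg g≤f)
        case (g , inj₂ k≤g , g≤f) = solves-upward ψwk (≤T-trans k≤g g≤f)

    solves? : ∀ {k} → Solves a k → ∀ w → Dec (Solves (ψ w) k)
    solves? ak w = map′ (to (≤cone⇔solves ak w)) (from (≤cone⇔solves ak w)) (w ≤? cone ak)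

    cone-reflects-≤T : ∀ {k k′} (ak : Solves a k) (ak′ : Solves a k′) → ¬ Solves b k′ →
                       cone ak ≤ cone ak′ → k ≤T k′
    cone-reflects-≤T {k} ak ak′ ¬bk′ cone≤cone′ =
      case (≤w⇒solves (proj₂ (proj₂ (conePreimage ak))) (to (≤cone⇔solves ak′ (cone ak)) cone≤cone′))
      where
      case : Solves (ConeProblem k) _ → k ≤T _
      case (g , inj₁ bg , g≤k′)  = contradiction (solves-upward bg g≤k′) ¬bk′
      case (g , inj₂ k≤g , g≤k′) = ≤T-trans k≤g g≤k′

    AvoidProblem : Baire → MassProblem
    AvoidProblem j f = Solves a f × ¬ f ≤T j

    private
      avoidPreimage : ∀ {j} → ¬ Solves b j → ∃ λ x → ψ x ≡w AvoidProblem j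
      avoidPreimage ¬bj = preimage _
        (λ f → proj₁)
        (λ f bf → f , (≤w⇒solves a≤b (f , bf , ≤T-refl) , λ f≤j → ¬bj (f , bf , f≤j)) , ≤T-refl)

    avoid : ∀ {j} → ¬ Solves b j → Carrier
    avoid = proj₁ ∘ avoidPreimage

    avoid≤⇔unsolved : ∀ {j} (¬bj : ¬ Solves b j) w → avoid ¬bj ≤ w ⇔ (¬ Solves (ψ w) j)
    avoid≤⇔unsolved {j} ¬bj w = mk⇔ avoid≤⇒unsolved unsolved⇒avoid≤
      where
      ψavoid≡wX : ψ (avoid ¬bj) ≡w AvoidProblem j
      ψavoid≡wX = proj₂ (avoidPreimage ¬bj)

      avoid≤⇒unsolved : avoid ¬bj ≤ w → ¬ Solves (ψ w) j
      avoid≤⇒unsolved avoid≤w ψwj with ≤w⇒solves (proj₂ ψavoid≡wX) (ψ-antitone avoid≤w ψwj)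
      ... | g , (_ , g≰j) , g≤j = g≰j g≤j

      unsolved⇒avoid≤ : ¬ Solves (ψ w) j → avoid ¬bj ≤ w
      unsolved⇒avoid≤ ¬ψwj = ψ-reflects λ { f (g , ψwg , g≤f) →
        ≤w⇒solves (proj₁ ψavoid≡wX) (g , (ψ⇒a (g , ψwg , ≤T-refl) , λ g≤j → ¬ψwj (g , ψwg , g≤j)) , g≤f) }

    avoid-splits : ∀ {j} (aj : Solves a j) (¬bj : ¬ Solves b j) → Splits (avoid ¬bj) (cone aj)
    avoid-splits aj ¬bj w =
      mk⇔ (λ avoid≤w w≤cone → to (avoid≤⇔unsolved ¬bj w) avoid≤w (to (≤cone⇔solves aj w) w≤cone))
          (λ w≰cone → from (avoid≤⇔unsolved ¬bj w) (w≰cone ∘ from (≤cone⇔solves aj w)))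

    -- By ≤cone⇔solves, an isolator of p solves exactly the ψ w with p ≰ w.
    record Isolator (p : Carrier) : Set (c ⊔ ℓ) where
      field
        oracle   : Baire
        solves-a : Solves a oracle
        splits   : Splits p (cone solves-a)

      unsolved : ¬ Solves (ψ p) oracle
      unsolved = to (splits p) ≤-refl ∘ from (≤cone⇔solves solves-a p)

      unsolved-b : ¬ Solves b oracle
      unsolved-b = unsolved ∘ b⇒ψ

    open Isolator

    -- As p ≰ m, some oracle solves ψ m but not ψ p, and any such oracle isolates p.
    isolator : ∀ {p} → JI p → ¬ ¬ Isolator p
    isolator {p} jp ¬isolator = p≰m (ψ-reflects λ k ψmk →
        decidable-stable (solves? (ψ⇒a ψmk) p) (λ ¬ψpk → ¬isolator (isolatorFrom ψmk ¬ψpk)))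
      where
      m : Carrier
      m = proj₁ (JI⇒Splits _≤?_ jp)

      p-splits-m : Splits p m
      p-splits-m = proj₂ (JI⇒Splits _≤?_ jp)

      p≰m : ¬ p ≤ m
      p≰m = to (p-splits-m p) ≤-refl

      isolatorFrom : ∀ {k} → Solves (ψ m) k → ¬ Solves (ψ p) k → Isolator p
      isolatorFrom {k} ψmk ¬ψpk = record { oracle = k ; solves-a = ak ; splits = splits′ }
        where
        ak : Solves a k
        ak = ψ⇒a ψmk

        splits′ : Splits p (cone ak)
        splits′ w = mk⇔
          (λ p≤w w≤cone → ¬ψpk (ψ-antitone p≤w (to (≤cone⇔solves ak w) w≤cone)))
          (λ w≰cone → from (p-splits-m w) λ w≤m →
             w≰cone (from (≤cone⇔solves ak w) (ψ-antitone w≤m ψmk)))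

    isolator-monotone : ∀ {p r} → p ≤ r → (Ip : Isolator p) (Ir : Isolator r) → oracle Ip ≤T oracle Ir
    isolator-monotone p≤r Ip Ir =
      cone-reflects-≤T (solves-a Ip) (solves-a Ir) (unsolved-b Ir)
        (decidable-stable (cone (solves-a Ip) ≤? cone (solves-a Ir)) λ coneₚ≰coneᵣ →
          to (splits Ip _) (≤-trans p≤r (from (splits Ir _) coneₚ≰coneᵣ)) ≤-refl)

    isolated≤avoid : ∀ {p j} (Ip : Isolator p) → oracle Ip ≤T j → (¬bj : ¬ Solves b j) → p ≤ avoid ¬bj
    isolated≤avoid Ip k≤j ¬bj = from (splits Ip _) λ avoid≤cone →
      to (avoid≤⇔unsolved ¬bj _) ≤-refl
         (solves-upward (to (≤cone⇔solves (solves-a Ip) _) avoid≤cone) k≤j)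

    avoid≤isolated : ∀ {t j} (It : Isolator t) → j ≤T oracle It → (¬bj : ¬ Solves b j) → avoid ¬bj ≤ t
    avoid≤isolated It j≤k ¬bj = from (avoid≤⇔unsolved ¬bj _) λ ψtj → unsolved It (solves-upward ψtj j≤k)

  boundedJoins : BoundedJoins (_≤J_ L)
  boundedJoins x@(p , jp) y@(q , jq) (r , jr) p≤r q≤r ¬lub =
    isolator jp λ Ip → isolator jq λ Iq → isolator jr λ Ir → ¬lub (lub Ip Iq Ir)
    where
    a≤b : a ≤w b
    a≤b = solves⇒≤w (λ k → ψ⇒a {p} ∘ b⇒ψ)

    open WithinBounds a≤b
    open Isolator

    lub : Isolator p → Isolator q → Isolator r → ∃ (IsLub (_≤J_ L) x y)
    lub Ip Iq Ir =
      (avoid ¬bj , Splits⇒JI _≤?_ (avoid-splits aj ¬bj)) ,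
      isolated≤avoid Ip kp≤j ¬bj , isolated≤avoid Iq kq≤j ¬bj , least
      where
      j : Baire
      j = oracle Ip ⊕ oracle Iq

      kp≤j : oracle Ip ≤T j
      kp≤j = ⊕-upperˡ (oracle Ip) (oracle Iq)

      kq≤j : oracle Iq ≤T j
      kq≤j = ⊕-upperʳ (oracle Ip) (oracle Iq)

      aj : Solves a j
      aj = solves-upward (solves-a Ip) kp≤j

      ¬bj : ¬ Solves b j
      ¬bj bj = unsolved-b Ir (solves-upward bj
        (⊕-least (isolator-monotone p≤r Ip Ir) (isolator-monotone q≤r Iq Ir)))

      least : ∀ t → _≤J_ L x t → _≤J_ L y t → avoid ¬bj ≤ proj₁ t
      least (t , jt) p≤t q≤t = decidable-stable (avoid ¬bj ≤? t) (¬¬-map (λ It →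
        avoid≤isolated It (⊕-least (isolator-monotone p≤t Ip It) (isolator-monotone q≤t Iq It)) ¬bj)
        (isolator jt))

theorem3p11 : {c ℓ : Level} (L : DistributiveLattice c ℓ) →
    IsFiniteLattice L →
    ¬ IsInitialSegmentOfFiniteUSL (JCarrier L) (_≤J_ L) →
    ¬ (Σ MassProblem λ a → Σ MassProblem λ b → IsoToMuchnikInterval L a b)
theorem3p11 L finite ¬segment (a , b , iso) =
  ¬¬-decidable-≤ λ _≤?_ →
  ¬¬-decidable-JI λ JI? →
  ¬segment (boundedJoins⇒initialSegment ≤-refl ≤-trans (λ x y → proj₁ x ≤? proj₁ y)
              (enumerateJ _≤?_ JI?) (Interval.boundedJoins L finite _≤?_ iso))
  where
  open LatticeOrder L
  open Finite finite
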